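{- Let $r\ge 2$ and let $H_r$ be the graph with vertex set $\{v_1,\dots,v_{2r},x_1,x_2\}$ in which $v_1,\dots,v_{2r}$ are pairwise adjacent (forming a complete graph $K_{2r}$), $x_1$ is adjacent exactly to $v_1,\dots,v_r$, and $x_2$ is adjacent exactly to $v_{r+1},\dots,v_{2r}$ (in particular $x_1,x_2$ are not adjacent). Then $H_r$ is chordal and $\mathrm{Ind}_{r+1}(H_r)$ is not sequentially Cohen-Macaulay.
   Context: For $s\ge1$, a subset $A\subseteq V(G)$ is $s$-independent if every connected component of the induced subgraph $G[A]$ has at most $s$ vertices; $\mathrm{Ind}_s(G)$ is the simplicial complex on $V(G)$ whose faces are the $s$-independent subsets. For a simplicial complex $\mathcal K$ and $m\ge1$, the pure $m$-skeleton $\mathcal K^{[m]}$ is the subcomplex generated by all $m$-dimensional faces of $\mathcal K$; $\mathcal K$ is sequentially Cohen-Macaulay if $\mathcal K^{[m]}$ is Cohen-Macaulay for all $m=1,\dots,\dim\mathcal K$. -}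

module Defs where

open import Level using (Level; _⊔_)
open import Data.Nat as ℕ using (ℕ; zero; suc; _<_; _≤_)
open import Data.Fin as Fin using (Fin; toℕ; inject₁; fromℕ)
open import Data.Fin.Subset using (Subset; _∈_; _∉_; _∪_; _⊆_; ⁅_⁆; ∣_∣; inside; outside)
open import Data.Vec using (lookup)
open import Data.List using (List; foldr; allFin)
open import Data.Bool using (Bool; true; false; if_then_else_)
open import Data.Product using (Σ; ∃; ∃-syntax; _×_; _,_)
open import Data.Empty using (⊥)
open import Relation.Nullary using (¬_; does)
open import Relation.Binary.PropositionalEquality using (_≡_; _≢_)
open import Function.Definitions using (Injective)
open import Algebra.Bundles using (CommutativeRing)

record Field (c ℓ : Level) : Set (Level.suc (c ⊔ ℓ)) where
  field
    commutativeRing : CommutativeRing c ℓ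
  open CommutativeRing commutativeRing public
  field
    1#≉0# : ¬ (1# ≈ 0#)
    inverse : ∀ x → ¬ (x ≈ 0#) → ∃[ y ] (x * y ≈ 1#)

record Graph : Set₁ where
  field
    n     : ℕ
    Adj   : Fin n → Fin n → Set
    sym   : ∀ {u v} → Adj u v → Adj v u
    irrefl : ∀ {u} → ¬ Adj u u
open Graph public

data Reach (G : Graph) (A : Subset (n G)) (u : Fin (n G)) : Fin (n G) → Set where
  here : u ∈ A → Reach G A u u
  step : ∀ {v w} → Reach G A u v → Adj G v w → w ∈ A → Reach G A u w

-- A is s-independent: every connected component of G[A] has at most s
-- vertices, i.e. there are no s+1 distinct vertices of A all in the
-- same component of G[A].
SIndependent : (s : ℕ) (G : Graph) → Subset (n G) → Set
SIndependent s G A =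
  (f : Fin (suc s) → Fin (n G)) → Injective _≡_ _≡_ f →
  (∀ i → Reach G A (f Fin.zero) (f i)) → ⊥

-- A cycle of length k = 4 + m is an injective c : Fin k → V with
-- c i ~ c (i+1) for i < k-1 and c (k-1) ~ c 0.
-- A chord joins c i, c j with i + 2 ≤ j that are not the pair {0, k-1}.
Chordal : Graph → Set
Chordal G =
  (m : ℕ) (c : Fin (4 ℕ.+ m) → Fin (n G)) → Injective _≡_ _≡_ c →
  (∀ (i : Fin (3 ℕ.+ m)) → Adj G (c (inject₁ i)) (c (Fin.suc i))) →
  Adj G (c (fromℕ (3 ℕ.+ m))) (c Fin.zero) →
  ∃[ i ] ∃[ j ] (2 ℕ.+ toℕ i ≤ toℕ j × ¬ (toℕ i ≡ 0 × toℕ j ≡ 3 ℕ.+ m) × Adj G (c i) (c j))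

-- The graph H_r on Fin (2r+2): vertex k (k < 2r) is v_{k+1},
-- vertex 2r is x₁, vertex 2r+1 is x₂.

data HAdj (r : ℕ) (i j : Fin (r ℕ.+ r ℕ.+ 2)) : Set where
  vv  : toℕ i < r ℕ.+ r → toℕ j < r ℕ.+ r → toℕ i ≢ toℕ j → HAdj r i j
  x₁v : toℕ i ≡ r ℕ.+ r → toℕ j < r → HAdj r i j
  vx₁ : toℕ i < r → toℕ j ≡ r ℕ.+ r → HAdj r i j
  x₂v : toℕ i ≡ suc (r ℕ.+ r) → r ≤ toℕ j → toℕ j < r ℕ.+ r → HAdj r i j
  vx₂ : r ≤ toℕ i → toℕ i < r ℕ.+ r → toℕ j ≡ suc (r ℕ.+ r) → HAdj r i j

private
  HAdj-sym : ∀ {r i j} → HAdj r i j → HAdj r j i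
  HAdj-sym (vv p q ne) = vv q p (λ e → ne (Relation.Binary.PropositionalEquality.sym e))
  HAdj-sym (x₁v p q) = vx₁ q p
  HAdj-sym (vx₁ p q) = x₁v q p
  HAdj-sym (x₂v p q s) = vx₂ q s p
  HAdj-sym (vx₂ p q s) = x₂v s p q

  open import Data.Nat.Properties using (<⇒≢)
  open Relation.Binary.PropositionalEquality using (refl; trans) renaming (sym to ≡-sym)

  HAdj-irrefl : ∀ {r i} → ¬ HAdj r i i
  HAdj-irrefl (vv p q ne) = ne refl
  HAdj-irrefl {r} (x₁v p q) = <⇒≢ (Data.Nat.Properties.<-≤-trans q (Data.Nat.Properties.m≤m+n r r)) p
  HAdj-irrefl {r} (vx₁ p q) = <⇒≢ (Data.Nat.Properties.<-≤-trans p (Data.Nat.Properties.m≤m+n r r)) q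
  HAdj-irrefl {r} (x₂v p q s) = <⇒≢ (Data.Nat.Properties.<-trans s (Data.Nat.Properties.n<1+n (r ℕ.+ r))) p
  HAdj-irrefl {r} (vx₂ p q s) = <⇒≢ (Data.Nat.Properties.<-trans q (Data.Nat.Properties.n<1+n (r ℕ.+ r))) s

H : ℕ → Graph
H r = record { n = r ℕ.+ r ℕ.+ 2 ; Adj = HAdj r ; sym = HAdj-sym ; irrefl = HAdj-irrefl }

-- Simplicial complexes on the vertex set Fin n, given by their set of
-- faces (a predicate on subsets). A face σ has dimension ∣ σ ∣ - 1.

Complex : ℕ → Set₁
Complex n = Subset n → Set

Ind : ℕ → (G : Graph) → Complex (n G)
Ind s G = SIndependent s G

Link : ∀ {n} → Complex n → Subset n → Complex n
Link K F G = (∀ v → v ∈ G → v ∉ F) × K (G ∪ F)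

PureSkeleton : ∀ {n} → Complex n → ℕ → Complex n
PureSkeleton K m σ = ∃[ τ ] (K τ × ∣ τ ∣ ≡ suc m × σ ⊆ τ)

-- Reduced simplicial homology with coefficients in a field 𝕜.
-- Faces are oriented by the order of Fin n.

module Homology {c ℓ} (𝕜 : Field c ℓ) {n : ℕ} where
  open Field 𝕜

  Σ[v] : (Fin n → Carrier) → Carrier
  Σ[v] f = foldr (λ v acc → f v + acc) 0# (allFin n)

  below : Subset n → Fin n → ℕ
  below τ v = foldr (λ u acc → if (lookup τ u Data.Bool.∧ does (u Fin.<? v)) then suc acc else acc) 0 (allFin n)
    where import Data.Bool

  sgn : ℕ → Carrier
  sgn zero = 1#
  sgn (suc k) = - sgn k

  -- (j-1)-chains are functions on faces with j vertices (j = 0: the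
  -- empty face, giving the augmentation / reduced homology), vanishing
  -- off such faces of K.
  Chain : Complex n → ℕ → (Subset n → Carrier) → Set ℓ
  Chain K j γ = ∀ σ → ¬ (K σ × ∣ σ ∣ ≡ j) → γ σ ≈ 0#

  ∂ : (Subset n → Carrier) → Subset n → Carrier
  ∂ γ τ = Σ[v] (λ v → if lookup τ v then 0# else sgn (below τ v) * γ (τ ∪ ⁅ v ⁆))

  -- H̃_{j-1}(K ; 𝕜) = 0 : every (j-1)-cycle is a boundary.
  ReducedHomologyVanishes : Complex n → ℕ → Set (c ⊔ ℓ)
  ReducedHomologyVanishes K j =
    ∀ γ → Chain K j γ → (∀ τ → ∂ γ τ ≈ 0#) →
    ∃[ δ ] (Chain K (suc j) δ × ∀ σ → ∂ δ σ ≈ γ σ)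

-- Cohen–Macaulay over 𝕜 (Reisner's criterion): for every face F of K
-- and every i < dim lk_K F, H̃_i(lk_K F ; 𝕜) = 0.  Writing j = i + 1,
-- i < dim lk F  iff  lk F has a face with more than j vertices.
CohenMacaulay : ∀ {c ℓ} (𝕜 : Field c ℓ) {n} → Complex n → Set (c ⊔ ℓ)
CohenMacaulay 𝕜 K =
  ∀ F → K F → ∀ j → ∃[ G ] (Link K F G × j < ∣ G ∣) →
  Homology.ReducedHomologyVanishes 𝕜 (Link K F) j

-- Sequentially Cohen–Macaulay: K^[m] is Cohen–Macaulay for every
-- m = 1, …, dim K  (m ≤ dim K iff K has a face with ≥ m+1 vertices).
SequentiallyCohenMacaulay : ∀ {c ℓ} (𝕜 : Field c ℓ) {n} → Complex n → Set (c ⊔ ℓ)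
SequentiallyCohenMacaulay 𝕜 K =
  ∀ m → 1 ≤ m → ∃[ σ ] (K σ × suc m ≤ ∣ σ ∣) →
  CohenMacaulay 𝕜 (PureSkeleton K m)

-- H_r is a split graph: the clique K_2r together with the independent set {x₁, x₂}; split graphs
-- are chordal.  For the second claim let K be the pure (r+1)-skeleton of Ind_{r+1}(H_r) and F = {x₁, x₂}.
-- Writing A = {v₁ … v_r} and B = {v_{r+1} … v_2r}, both A ∪ F and B ∪ F are (r+1)-independent, since
-- x₂ resp. x₁ is isolated in them; so lk_K F contains the vertices of A and B and the face A of
-- dimension r - 1 ≥ 1.  No edge of lk_K F joins A to B: a face containing v ∈ A, w ∈ B and F induces a
-- connected subgraph on r + 2 vertices.  Hence lk_K F is disconnected, H̃₀(lk_K F) ≠ 0, and K violates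
-- Reisner's criterion.  Concretely, for z₀ ∈ A and z₁ ∈ B the 0-chain [z₀] - [z₁] is a cycle, whereas
-- the coefficients of any boundary of a 1-chain sum to zero over A.

module Submission where

open import Defs hiding (n; sym; irrefl)
open import Level using (Level)
open import Algebra.Bundles using (CommutativeMonoid)
open import Data.Bool.Base as Bool using (Bool; true; false; if_then_else_; _∧_)
import Data.Bool.Properties as Bool
open import Data.Nat.Base as ℕ using (ℕ; zero; suc; _≤_; _<_; z≤n; s≤s)
open import Data.Nat.Properties as ℕ using (+-0-commutativeMonoid)
open import Data.Fin.Base as Fin using (Fin; zero; suc; toℕ; fromℕ; fromℕ<; _↑ʳ_; reduce≥; punchIn)
open import Data.Fin.Patterns using (0F; 1F; 2F; 3F)
open import Data.Fin.Properties using (_≟_; <-cmp; 0≢1+n; suc-injective; punchInᵢ≢i; toℕ-injective; toℕ-fromℕ; toℕ-fromℕ<; toℕ-↑ʳ; toℕ<n)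
import Data.Fin.Properties as Fin
open import Data.Fin.Subset using (Subset; _∈_; _∉_; _⊆_; _∪_; ⁅_⁆; ∣_∣; ⊤; ⊥; inside; outside)
open import Data.Fin.Subset.Properties using (x∈⁅x⁆; x∈⁅y⁆⇒x≡y; x∈p∪q⁺; x∈p∪q⁻; ∪-comm; ∪-identityˡ; ∣⁅x⁆∣≡1; ∣⊤∣≡n; ∣⊥∣≡0; nonempty?; Empty-unique; x∈p∧x≢y⇒x∈p-y; x∈p⇒∣p-x∣<∣p∣)
open import Data.List.Base as List using ()
open import Data.Product using (_×_; _,_; proj₂; ∃-syntax; Σ-syntax; uncurry)
open import Data.Sum using (_⊎_; inj₁; inj₂)
open import Data.Vec.Base using ([]; _∷_; _++_; replicate; lookup; here; there)
open import Data.Vec.Functional as Vector using (Vector)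
open import Data.Vec.Properties using ([]=⇒lookup; lookup⇒[]=; lookup-replicate; lookup-++-<; lookup-++-≥; lookup-++ʳ; ≡-dec)
open import Function.Base using (_∘_; id)
open import Function.Definitions using (Injective)
open import Relation.Binary.Definitions using (tri<; tri≈; tri>)
open import Relation.Binary.PropositionalEquality as ≡ using (_≡_; _≢_)
open import Relation.Nullary using (¬_; Dec; does; yes; no; contradiction)
open import Relation.Nullary.Decidable using (dec-true; dec-false)
open import Relation.Unary using (Decidable)

-- Finite sums

module FiniteSums {a ℓ} (M : CommutativeMonoid a ℓ) where
  open CommutativeMonoid M
    renaming (_∙_ to _+_; ε to 0#; ∙-cong to +-cong; identityˡ to +-identityˡ; identityʳ to +-identityʳ)
  open import Algebra.Properties.CommutativeMonoid.Sum M using (sum; sum-cong-≋; sum-replicate-zero; sum-remove; ∑-distrib-+)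
  open import Relation.Binary.Reasoning.Setoid setoid

  sum-≈0 : ∀ {k} {f : Vector Carrier k} → (∀ i → f i ≈ 0#) → sum f ≈ 0#
  sum-≈0 {k} f≈0 = trans (sum-cong-≋ f≈0) (sum-replicate-zero k)

  sum-concentrated : ∀ {k} (f : Vector Carrier k) (z : Fin k) → (∀ i → i ≢ z → f i ≈ 0#) → sum f ≈ f z
  sum-concentrated {suc k} f z f≈0 = begin
    sum f                      ≈⟨ sum-remove f ⟩
    f z + sum (f ∘ punchIn z)  ≈⟨ +-cong refl (sum-≈0 (λ i → f≈0 (punchIn z i) (punchInᵢ≢i z i))) ⟩
    f z + 0#                   ≈⟨ +-identityʳ (f z) ⟩
    f z                        ∎

  -- By induction rather than by exchanging the sums, which would only give S + S ≈ 0.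
  sum-sum-skew≈0 : ∀ {k} (h : Fin k → Fin k → Carrier) → (∀ i → h i i ≈ 0#) →
                   (∀ i j → h i j + h j i ≈ 0#) → sum (λ i → sum (h i)) ≈ 0#
  sum-sum-skew≈0 {zero}  h diag skew = refl
  sum-sum-skew≈0 {suc k} h diag skew = begin
    (h 0F 0F + row) + sum (λ i → h (suc i) 0F + sum (h′ i))  ≈⟨ +-cong (+-cong (diag 0F) refl) (∑-distrib-+ _ (sum ∘ h′)) ⟩
    (0# + row) + (column + sum (sum ∘ h′))                    ≈⟨ +-cong (+-identityˡ row) (+-cong refl inner≈0) ⟩
    row + (column + 0#)                                       ≈⟨ +-cong refl (+-identityʳ column) ⟩
    row + column                                              ≈⟨ sym (∑-distrib-+ (λ j → h 0F (suc j)) (λ j → h (suc j) 0F)) ⟩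
    sum (λ j → h 0F (suc j) + h (suc j) 0F)                   ≈⟨ sum-≈0 (λ j → skew 0F (suc j)) ⟩
    0#                                                        ∎
    where
    h′ : Fin k → Fin k → Carrier
    h′ i j = h (suc i) (suc j)
    row column : Carrier
    row = sum (λ j → h 0F (suc j))
    column = sum (λ i → h (suc i) 0F)
    inner≈0 : sum (sum ∘ h′) ≈ 0#
    inner≈0 = sum-sum-skew≈0 h′ (diag ∘ suc) (λ i j → skew (suc i) (suc j))

  foldr-tabulate : ∀ {k m} (f : Fin m → Carrier) (g : Fin k → Fin m) →
                   List.foldr (λ v acc → f v + acc) 0# (List.tabulate g) ≡ sum (f ∘ g)
  foldr-tabulate {zero}  f g = ≡.refl
  foldr-tabulate {suc k} f g = ≡.cong (f (g zero) +_) (foldr-tabulate f (g ∘ suc))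

open import Algebra.Properties.CommutativeMonoid.Sum +-0-commutativeMonoid using () renaming (sum to sumℕ)
open FiniteSums +-0-commutativeMonoid using () renaming (sum-≈0 to sumℕ≡0; sum-concentrated to sumℕ-concentrated)

foldr-count : ∀ {k m} (P : Fin m → Bool) (g : Fin k → Fin m) →
  List.foldr (λ u acc → if P u then suc acc else acc) 0 (List.tabulate g) ≡ sumℕ (λ i → if P (g i) then 1 else 0)
foldr-count {zero}  P g = ≡.refl
foldr-count {suc k} P g with P (g zero)
... | true  = ≡.cong suc (foldr-count P (g ∘ suc))
... | false = foldr-count P (g ∘ suc)

-- Subsets of Fin n

lookup-∈ : ∀ {n} {p : Subset n} {x} → x ∈ p → lookup p x ≡ true
lookup-∈ = []=⇒lookup

∈-lookup : ∀ {n} {p : Subset n} {x} → lookup p x ≡ true → x ∈ p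
∈-lookup {x = x} = lookup⇒[]= x _

∉-lookup : ∀ {n} {p : Subset n} {x} → lookup p x ≡ false → x ∉ p
∉-lookup px≡false x∈p with ≡.trans (≡.sym (lookup-∈ x∈p)) px≡false
... | ()

lookup-⁅x⁆-≢ : ∀ {n} {x y : Fin n} → x ≢ y → lookup ⁅ y ⁆ x ≡ false
lookup-⁅x⁆-≢ {x = x} {y} x≢y with lookup ⁅ y ⁆ x in eq
... | true  = contradiction (x∈⁅y⁆⇒x≡y y (∈-lookup eq)) x≢y
... | false = ≡.refl

⁅⁆-injective : ∀ {n} {x y : Fin n} → ⁅ x ⁆ ≡ ⁅ y ⁆ → x ≡ y
⁅⁆-injective {x = x} {y} eq = x∈⁅y⁆⇒x≡y y (≡.subst (x ∈_) eq (x∈⁅x⁆ x))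

∪-⊆ : ∀ {n} {p q r : Subset n} → p ⊆ r → q ⊆ r → p ∪ q ⊆ r
∪-⊆ {p = p} {q} p⊆r q⊆r x∈p∪q with x∈p∪q⁻ p q x∈p∪q
... | inj₁ x∈p = p⊆r x∈p
... | inj₂ x∈q = q⊆r x∈q

⁅x⁆⊆p : ∀ {n} {p : Subset n} {x} → x ∈ p → ⁅ x ⁆ ⊆ p
⁅x⁆⊆p {x = x} x∈p y∈⁅x⁆ = ≡.subst (_∈ _) (≡.sym (x∈⁅y⁆⇒x≡y x y∈⁅x⁆)) x∈p

∷-injective : ∀ {m n} {x : Fin n} {f : Fin m → Fin n} →
  (∀ i → f i ≢ x) → Injective _≡_ _≡_ f → Injective _≡_ _≡_ (x Vector.∷ f)
∷-injective f≢x f-inj {zero}  {zero}  _  = ≡.refl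
∷-injective f≢x f-inj {zero}  {suc j} eq = contradiction (≡.sym eq) (f≢x j)
∷-injective f≢x f-inj {suc i} {zero}  eq = contradiction eq (f≢x i)
∷-injective f≢x f-inj {suc i} {suc j} eq = ≡.cong suc (f-inj eq)

injective⇒≤∣p∣ : ∀ {m n} {p : Subset n} (f : Fin m → Fin n) →
  Injective _≡_ _≡_ f → (∀ i → f i ∈ p) → m ≤ ∣ p ∣
injective⇒≤∣p∣ {zero}  f f-inj f∈p = z≤n
injective⇒≤∣p∣ {suc m} f f-inj f∈p = ℕ.≤-trans (s≤s (injective⇒≤∣p∣ (f ∘ suc) (suc-injective ∘ f-inj) f-suc∈))
                                              (x∈p⇒∣p-x∣<∣p∣ (f∈p zero))
  where
  f-suc∈ : ∀ i → f (suc i) ∈ _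
  f-suc∈ i = x∈p∧x≢y⇒x∈p-y (f∈p (suc i)) λ eq → 0≢1+n (≡.sym (f-inj eq))

enumerate : ∀ {n k} (p : Subset n) → k ≤ ∣ p ∣ →
  Σ[ f ∈ (Fin k → Fin n) ] (Injective _≡_ _≡_ f × ∀ i → f i ∈ p)
enumerate {k = zero} p _ = (λ ()) , (λ { {()} }) , λ ()
enumerate (outside ∷ p) k≤∣p∣ with enumerate p k≤∣p∣
... | f , f-inj , f∈p = suc ∘ f , f-inj ∘ suc-injective , there ∘ f∈p
enumerate {k = suc k} (inside ∷ p) (s≤s k≤∣p∣) with enumerate p k≤∣p∣
... | f , f-inj , f∈p = zero Vector.∷ (suc ∘ f) , ∷-injective (λ _ ()) (f-inj ∘ suc-injective) , λ where
  zero    → here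
  (suc i) → there (f∈p i)

-- Reduced homology in degree 0

module ReducedH₀ {c ℓ} (𝕜 : Field c ℓ) {n : ℕ} where
  open Field 𝕜
  open Homology 𝕜 {n}
  open FiniteSums +-commutativeMonoid
  open import Algebra.Properties.CommutativeMonoid.Sum +-commutativeMonoid using (sum; sum-cong-≋; ∑-distrib-+)
  open import Relation.Binary.Reasoning.Setoid setoid

  Σ[v]≡sum : (f : Fin n → Carrier) → Σ[v] f ≡ sum f
  Σ[v]≡sum f = foldr-tabulate f id

  below≡sum : ∀ τ v → below τ v ≡ sumℕ (λ u → if lookup τ u ∧ does (u Fin.<? v) then 1 else 0)
  below≡sum τ v = foldr-count (λ u → lookup τ u ∧ does (u Fin.<? v)) id

  below-⊥ : ∀ v → below ⊥ v ≡ 0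
  below-⊥ v = ≡.trans (below≡sum ⊥ v) (sumℕ≡0 λ u →
    ≡.cong (λ b → if b ∧ does (u Fin.<? v) then 1 else 0) (lookup-replicate {n = n} u false))

  below-⁅⁆ : ∀ u v → below ⁅ u ⁆ v ≡ (if does (u Fin.<? v) then 1 else 0)
  below-⁅⁆ u v = ≡.trans (below≡sum ⁅ u ⁆ v) (≡.trans
    (sumℕ-concentrated _ u λ w w≢u → ≡.cong (λ b → if b ∧ does (w Fin.<? v) then 1 else 0) (lookup-⁅x⁆-≢ w≢u))
    (≡.cong (λ b → if b ∧ does (u Fin.<? v) then 1 else 0) (lookup-∈ (x∈⁅x⁆ u))))

  sgn-below-⁅⁆-skew : ∀ {u v} → u ≢ v → sgn (below ⁅ u ⁆ v) + sgn (below ⁅ v ⁆ u) ≈ 0#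
  sgn-below-⁅⁆-skew {u} {v} u≢v rewrite below-⁅⁆ u v | below-⁅⁆ v u with <-cmp u v
  ... | tri< u<v _ _ rewrite dec-true (u Fin.<? v) u<v | dec-false (v Fin.<? u) (Fin.<-asym u<v) = -‿inverseˡ 1#
  ... | tri≈ _ u≡v _ = contradiction u≡v u≢v
  ... | tri> _ _ v<u rewrite dec-false (u Fin.<? v) (Fin.<-asym v<u) | dec-true (v Fin.<? u) v<u = -‿inverseʳ 1#

  ∂-term : (Subset n → Carrier) → Subset n → Fin n → Carrier
  ∂-term γ τ v = if lookup τ v then 0# else sgn (below τ v) * γ (τ ∪ ⁅ v ⁆)

  ∂≡sum : ∀ γ τ → ∂ γ τ ≡ sum (∂-term γ τ)
  ∂≡sum γ τ = Σ[v]≡sum (∂-term γ τ)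

  ∂-term-⁅⁆-skew : ∀ δ u v → ∂-term δ ⁅ u ⁆ v + ∂-term δ ⁅ v ⁆ u ≈ 0#
  ∂-term-⁅⁆-skew δ u v with u Fin.≟ v
  ... | yes ≡.refl rewrite lookup-∈ (x∈⁅x⁆ u) = +-identityˡ 0#
  ... | no u≢v rewrite lookup-⁅x⁆-≢ (u≢v ∘ ≡.sym) | lookup-⁅x⁆-≢ u≢v | ∪-comm ⁅ v ⁆ ⁅ u ⁆ = begin
    sgn (below ⁅ u ⁆ v) * edge + sgn (below ⁅ v ⁆ u) * edge  ≈⟨ sym (distribʳ edge _ _) ⟩
    (sgn (below ⁅ u ⁆ v) + sgn (below ⁅ v ⁆ u)) * edge        ≈⟨ *-congʳ (sgn-below-⁅⁆-skew u≢v) ⟩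
    0# * edge                                                ≈⟨ zeroˡ edge ⟩
    0#                                                       ∎
    where edge = δ (⁅ u ⁆ ∪ ⁅ v ⁆)

  weight : Subset n → (Subset n → Carrier) → Carrier
  weight A γ = sum (λ v → if lookup A v then γ ⁅ v ⁆ else 0#)

  weight-cong : ∀ A {γ γ′} → (∀ σ → γ σ ≈ γ′ σ) → weight A γ ≈ weight A γ′
  weight-cong A {γ} {γ′} γ≈γ′ = sum-cong-≋ λ v → on-vertex v (lookup A v)
    where
    on-vertex : ∀ v b → (if b then γ ⁅ v ⁆ else 0#) ≈ (if b then γ′ ⁅ v ⁆ else 0#)
    on-vertex v true  = γ≈γ′ ⁅ v ⁆
    on-vertex v false = refl

  weight-∂≈0 : ∀ A δ → (∀ {v w} → v ∈ A → w ∉ A → δ (⁅ v ⁆ ∪ ⁅ w ⁆) ≈ 0#) → weight A (∂ δ) ≈ 0#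
  weight-∂≈0 A δ no-crossing = begin
    weight A (∂ δ)               ≈⟨ sum-cong-≋ row ⟩
    sum (λ v → sum (h v))        ≈⟨ sum-sum-skew≈0 h diag skew ⟩
    0#                           ∎
    where
    h : Fin n → Fin n → Carrier
    h v w = if lookup A v ∧ lookup A w then ∂-term δ ⁅ v ⁆ w else 0#

    -- h is unfolded here so that the with-abstraction below sees lookup A v.
    row : ∀ v → (if lookup A v then ∂ δ ⁅ v ⁆ else 0#) ≈
                sum (λ w → if lookup A v ∧ lookup A w then ∂-term δ ⁅ v ⁆ w else 0#)
    row v with lookup A v in v∈A
    ... | false = sym (sum-≈0 {n} λ _ → refl)
    ... | true  = ≡.subst (_≈ sum (λ w → if lookup A w then ∂-term δ ⁅ v ⁆ w else 0#))
                          (≡.sym (∂≡sum δ ⁅ v ⁆)) (sum-cong-≋ column)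
      where
      column : ∀ w → ∂-term δ ⁅ v ⁆ w ≈ (if lookup A w then ∂-term δ ⁅ v ⁆ w else 0#)
      column w with lookup A w in w∈A | lookup ⁅ v ⁆ w
      ... | true  | _     = refl
      ... | false | true  = refl
      ... | false | false = trans (*-congˡ (no-crossing (∈-lookup v∈A) (∉-lookup w∈A))) (zeroʳ _)

    diag : ∀ v → h v v ≈ 0#
    diag v with lookup A v
    ... | false = refl
    ... | true rewrite lookup-∈ (x∈⁅x⁆ v) = refl

    skew : ∀ v w → h v w + h w v ≈ 0#
    skew v w with lookup A v | lookup A w
    ... | true  | true  = ∂-term-⁅⁆-skew δ v w
    ... | true  | false = +-identityˡ 0#
    ... | false | true  = +-identityˡ 0#
    ... | false | false = +-identityˡ 0#

  _≟ₛ_ : (σ τ : Subset n) → Dec (σ ≡ τ)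
  _≟ₛ_ = ≡-dec Bool._≟_

  point : Fin n → Carrier → Subset n → Carrier
  point z x σ = if does (σ ≟ₛ ⁅ z ⁆) then x else 0#

  point-at : ∀ z x → point z x ⁅ z ⁆ ≡ x
  point-at z x rewrite dec-true (⁅ z ⁆ ≟ₛ ⁅ z ⁆) ≡.refl = ≡.refl

  point-off : ∀ {z} x {σ} → σ ≢ ⁅ z ⁆ → point z x σ ≡ 0#
  point-off {z} x {σ} σ≢z rewrite dec-false (σ ≟ₛ ⁅ z ⁆) σ≢z = ≡.refl

  sum-point : ∀ z x → sum (λ v → point z x ⁅ v ⁆) ≈ x
  sum-point z x = trans (sum-concentrated _ z λ v v≢z → reflexive (point-off x (v≢z ∘ ⁅⁆-injective)))
                        (reflexive (point-at z x))

  ∂-⊥ : ∀ γ → ∂ γ ⊥ ≈ sum (λ v → γ ⁅ v ⁆)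
  ∂-⊥ γ = trans (reflexive (∂≡sum γ ⊥)) (sum-cong-≋ term)
    where
    term : ∀ v → ∂-term γ ⊥ v ≈ γ ⁅ v ⁆
    term v rewrite lookup-replicate {n = n} v false | below-⊥ v | ∪-identityˡ ⁅ v ⁆ = *-identityˡ (γ ⁅ v ⁆)

  ∂-nonempty≈0 : ∀ γ → (∀ σ → (∀ z → σ ≢ ⁅ z ⁆) → γ σ ≈ 0#) → ∀ {u τ} → u ∈ τ → ∂ γ τ ≈ 0#
  ∂-nonempty≈0 γ γ-on-vertices {u} {τ} u∈τ = trans (reflexive (∂≡sum γ τ)) (sum-≈0 term)
    where
    term : ∀ v → ∂-term γ τ v ≈ 0#
    term v with lookup τ v in v∈τ
    ... | true  = refl
    ... | false = trans (*-congˡ (γ-on-vertices _ not-vertex)) (zeroʳ _)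
      where
      not-vertex : ∀ z → τ ∪ ⁅ v ⁆ ≢ ⁅ z ⁆
      not-vertex z eq = ∉-lookup v∈τ (≡.subst (_∈ τ) u≡v u∈τ)
        where
        at-z : ∀ {x} → x ∈ τ ∪ ⁅ v ⁆ → x ≡ z
        at-z x∈ = x∈⁅y⁆⇒x≡y z (≡.subst (_ ∈_) eq x∈)
        u≡v : u ≡ v
        u≡v = ≡.trans (at-z (x∈p∪q⁺ (inj₁ u∈τ))) (≡.sym (at-z (x∈p∪q⁺ (inj₂ (x∈⁅x⁆ v)))))

  disconnected⇒¬H̃₀-vanishes : (L : Complex n) (A : Subset n) {z₀ z₁ : Fin n} →
    L ⁅ z₀ ⁆ → L ⁅ z₁ ⁆ → z₀ ∈ A → z₁ ∉ A →
    (∀ {v w} → v ∈ A → w ∉ A → ¬ L (⁅ v ⁆ ∪ ⁅ w ⁆)) →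
    ¬ ReducedHomologyVanishes L 1
  disconnected⇒¬H̃₀-vanishes L A {z₀} {z₁} L-z₀ L-z₁ z₀∈A z₁∉A cut vanishes =
    γ-not-boundary (vanishes γ γ-chain γ-cycle)
    where
    γ : Subset n → Carrier
    γ σ = point z₀ 1# σ + point z₁ (- 1#) σ

    z₀≢z₁ : z₀ ≢ z₁
    z₀≢z₁ z₀≡z₁ = z₁∉A (≡.subst (_∈ A) z₀≡z₁ z₀∈A)

    γ-off : ∀ {σ} → σ ≢ ⁅ z₀ ⁆ → σ ≢ ⁅ z₁ ⁆ → γ σ ≈ 0#
    γ-off σ≢z₀ σ≢z₁ =
      trans (+-cong (reflexive (point-off 1# σ≢z₀)) (reflexive (point-off (- 1#) σ≢z₁))) (+-identityˡ 0#)

    γ-chain : Chain L 1 γ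
    γ-chain σ not-vertex = γ-off {σ} (λ { ≡.refl → not-vertex (L-z₀ , ∣⁅x⁆∣≡1 z₀) })
                                 (λ { ≡.refl → not-vertex (L-z₁ , ∣⁅x⁆∣≡1 z₁) })

    γ-cycle : ∀ τ → ∂ γ τ ≈ 0#
    γ-cycle τ with nonempty? τ
    ... | yes (u , u∈τ) = ∂-nonempty≈0 γ (λ σ σ≢ → γ-off {σ} (σ≢ z₀) (σ≢ z₁)) u∈τ
    ... | no τ-empty rewrite Empty-unique τ-empty = begin
      ∂ γ ⊥                                  ≈⟨ ∂-⊥ γ ⟩
      sum (λ v → γ₀ ⁅ v ⁆ + γ₁ ⁅ v ⁆)          ≈⟨ ∑-distrib-+ (γ₀ ∘ ⁅_⁆) (γ₁ ∘ ⁅_⁆) ⟩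
      sum (γ₀ ∘ ⁅_⁆) + sum (γ₁ ∘ ⁅_⁆)         ≈⟨ +-cong (sum-point z₀ 1#) (sum-point z₁ (- 1#)) ⟩
      1# + - 1#                              ≈⟨ -‿inverseʳ 1# ⟩
      0#                                     ∎
      where
      γ₀ γ₁ : Subset n → Carrier
      γ₀ = point z₀ 1#
      γ₁ = point z₁ (- 1#)

    weight-γ : weight A γ ≈ 1#
    weight-γ = trans (sum-concentrated _ z₀ off-z₀) at-z₀
      where
      at-z₀ : (if lookup A z₀ then γ ⁅ z₀ ⁆ else 0#) ≈ 1#
      at-z₀ rewrite lookup-∈ z₀∈A | point-at z₀ 1# | point-off (- 1#) (z₀≢z₁ ∘ ⁅⁆-injective) = +-identityʳ 1#
      off-z₀ : ∀ v → v ≢ z₀ → (if lookup A v then γ ⁅ v ⁆ else 0#) ≈ 0#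
      off-z₀ v v≢z₀ with lookup A v in v∈A
      ... | false = refl
      ... | true  = γ-off (v≢z₀ ∘ ⁅⁆-injective)
                          (λ v≡z₁ → z₁∉A (≡.subst (_∈ A) (⁅⁆-injective v≡z₁) (∈-lookup v∈A)))

    γ-not-boundary : ¬ (∃[ δ ] (Chain L 2 δ × ∀ σ → ∂ δ σ ≈ γ σ))
    γ-not-boundary (δ , δ-chain , ∂δ≈γ) = 1#≉0# (begin
      1#              ≈⟨ sym weight-γ ⟩
      weight A γ      ≈⟨ sym (weight-cong A ∂δ≈γ) ⟩
      weight A (∂ δ)  ≈⟨ weight-∂≈0 A δ (λ v∈A w∉A → δ-chain _ λ (L-vw , _) → cut v∈A w∉A L-vw) ⟩
      0#              ∎)

-- Connectivity, s-independence and chordality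

-- Opened only now: above, _+_ is the addition of a monoid or field.
open import Data.Nat.Base using (_+_)
open import Data.Nat.Properties using (≤-refl; ≤-trans; ≤-reflexive; <-≤-trans; <-irrefl; m≤m+n; <⇒≱; +-comm; +-identityʳ)

module _ {G : Graph} {τ : Subset (Graph.n G)} where

  Reach⇒∈ : ∀ {u w} → Reach G τ u w → w ∈ τ
  Reach⇒∈ (here w∈τ)     = w∈τ
  Reach⇒∈ (step _ _ w∈τ) = w∈τ

  Reach-trans : ∀ {u v w} → Reach G τ u v → Reach G τ v w → Reach G τ u w
  Reach-trans u⇝v (here _)           = u⇝v
  Reach-trans u⇝v (step v⇝w′ adj w∈τ) = step (Reach-trans u⇝v v⇝w′) adj w∈τ

  Reach-sym : ∀ {u w} → Reach G τ u w → Reach G τ w u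
  Reach-sym (here u∈τ)          = here u∈τ
  Reach-sym (step u⇝v adj w∈τ) = Reach-trans (step (here w∈τ) (Graph.sym G adj) (Reach⇒∈ u⇝v)) (Reach-sym u⇝v)

  Reach-isolated : ∀ {z} → (∀ {a} → a ∈ τ → ¬ Adj G a z) → ∀ {u} → Reach G τ u z → u ≡ z
  Reach-isolated isolated (here _)          = ≡.refl
  Reach-isolated isolated (step u⇝v adj _) = contradiction adj (isolated (Reach⇒∈ u⇝v))

  connected⇒¬SIndependent : ∀ {s u} → (∀ {w} → w ∈ τ → Reach G τ u w) → suc s ≤ ∣ τ ∣ → ¬ SIndependent s G τ
  connected⇒¬SIndependent u⇝ s<∣τ∣ independent with enumerate τ s<∣τ∣
  ... | f , f-inj , f∈τ = independent f f-inj λ i → Reach-trans (Reach-sym (u⇝ (f∈τ zero))) (u⇝ (f∈τ i))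

  isolated⇒SIndependent : ∀ {s z} → z ∈ τ → (∀ {a} → a ∈ τ → ¬ Adj G a z) →
    ∣ τ ∣ ≤ suc (suc s) → SIndependent (suc s) G τ
  -- The component of z is {z}; any other component misses z, so has at most ∣ τ ∣ - 1 vertices.
  isolated⇒SIndependent {s} {z} z∈τ isolated ∣τ∣≤ f f-inj f₀⇝ with f 0F ≟ z
  ... | yes f₀≡z = 0≢1+n (f-inj (≡.trans f₀≡z (≡.sym f₁≡z)))
    where
    f₁≡z : f 1F ≡ z
    f₁≡z = Reach-isolated isolated (≡.subst (Reach G τ (f 1F)) f₀≡z (Reach-sym (f₀⇝ 1F)))
  ... | no f₀≢z = <-irrefl ≡.refl (≤-trans (injective⇒≤∣p∣ (z Vector.∷ f) (∷-injective f≢z f-inj) ∈τ) ∣τ∣≤)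
    where
    f≢z : ∀ i → f i ≢ z
    f≢z i fᵢ≡z = f₀≢z (Reach-isolated isolated (≡.subst (Reach G τ (f 0F)) fᵢ≡z (f₀⇝ i)))
    ∈τ : ∀ i → (z Vector.∷ f) i ∈ τ
    ∈τ zero    = z∈τ
    ∈τ (suc i) = Reach⇒∈ (f₀⇝ i)

module _ (G : Graph) {C : Fin (Graph.n G) → Set}
         (clique : ∀ {u v} → C u → C v → u ≢ v → Adj G u v)
         (cover : ∀ {u v} → Adj G u v → C u ⊎ C v) where

  private
    C-left : ∀ {u v} → Adj G u v → ¬ C v → C u
    C-left adj v∉C with cover adj
    ... | inj₁ u∈C = u∈C
    ... | inj₂ v∈C = contradiction v∈C v∉C

    C-right : ∀ {u v} → Adj G u v → ¬ C u → C v
    C-right adj u∉C = C-left (Graph.sym G adj) u∉C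

  -- If c₀ ∉ C then c₁, c_last ∈ C; otherwise c₀ c₂ is a chord, or c₂ ∉ C and c₁ c₃ is one.
  split⇒chordal : Decidable C → Chordal G
  split⇒chordal C? m c c-inj adj last with C? (c 0F) | C? (c 2F)
  ... | no c₀∉C | _ =
    1F , fromℕ (3 ℕ.+ m) , ≡.subst (3 ≤_) (≡.sym (toℕ-fromℕ (3 ℕ.+ m))) (m≤m+n 3 m) , (λ { (() , _) }) ,
    clique (C-right (adj 0F) c₀∉C) (C-left last c₀∉C) (λ eq → contradiction (c-inj eq) λ ())
  ... | yes c₀∈C | yes c₂∈C =
    0F , 2F , ≤-refl , (λ { (_ , ()) }) ,
    clique c₀∈C c₂∈C (λ eq → contradiction (c-inj eq) λ ())
  ... | yes _ | no c₂∉C =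
    1F , 3F , ≤-refl , (λ { (() , _) }) ,
    clique (C-left (adj 1F) c₂∉C) (C-right (adj 2F) c₂∉C) (λ eq → contradiction (c-inj eq) λ ())

-- The graph H_r

∣p++q∣≡∣p∣+∣q∣ : ∀ {m n} (p : Subset m) (q : Subset n) → ∣ p ++ q ∣ ≡ ∣ p ∣ + ∣ q ∣
∣p++q∣≡∣p∣+∣q∣ []          q = ≡.refl
∣p++q∣≡∣p∣+∣q∣ (true  ∷ p) q = ≡.cong suc (∣p++q∣≡∣p∣+∣q∣ p q)
∣p++q∣≡∣p∣+∣q∣ (false ∷ p) q = ∣p++q∣≡∣p∣+∣q∣ p q

module Hᵣ (r : ℕ) where

  open ≡.≡-Reasoning

  N : ℕ
  N = r + r + 2

  x₁ x₂ : Fin N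
  x₁ = (r + r) ↑ʳ 0F
  x₂ = (r + r) ↑ʳ 1F

  toℕ-x₁ : toℕ x₁ ≡ r + r
  toℕ-x₁ = ≡.trans (toℕ-↑ʳ (r + r) 0F) (+-identityʳ (r + r))

  toℕ-x₂ : toℕ x₂ ≡ suc (r + r)
  toℕ-x₂ = ≡.trans (toℕ-↑ʳ (r + r) 1F) (+-comm (r + r) 1)

  data Part : Fin N → Set where
    inA  : ∀ {i} → toℕ i < r → Part i
    inB  : ∀ {i} → r ≤ toℕ i → toℕ i < r + r → Part i
    isX₁ : Part x₁
    isX₂ : Part x₂

  part : ∀ i → Part i
  part i with toℕ i ℕ.<? r | toℕ i ℕ.<? r + r
  ... | yes i<r | _        = inA i<r
  ... | no i≮r  | yes i<2r = inB (ℕ.≮⇒≥ i≮r) i<2r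
  ... | no _    | no i≮2r with toℕ i ℕ.≟ r + r
  ...   | yes i≡2r = ≡.subst Part (toℕ-injective (≡.trans toℕ-x₁ (≡.sym i≡2r))) isX₁
  ...   | no i≢2r  = ≡.subst Part (toℕ-injective (≡.trans toℕ-x₂ (≡.sym i≡2r+1))) isX₂
    where
    i≡2r+1 : toℕ i ≡ suc (r + r)
    i≡2r+1 = ℕ.≤-antisym (ℕ.s≤s⁻¹ (≡.subst (toℕ i <_) (+-comm (r + r) 2) (toℕ<n i)))
                         (ℕ.≤∧≢⇒< (ℕ.≮⇒≥ i≮2r) (i≢2r ∘ ≡.sym))

  inA⇒clique : ∀ {v : Fin N} → toℕ v < r → toℕ v < r + r
  inA⇒clique v<r = <-≤-trans v<r (m≤m+n r r)

  inA≢inB : ∀ {v w : Fin N} → toℕ v < r → r ≤ toℕ w → v ≢ w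
  inA≢inB v<r r≤w ≡.refl = <⇒≱ v<r r≤w

  clique-adj : ∀ {u v : Fin N} → toℕ u < r + r → toℕ v < r + r → u ≢ v → HAdj r u v
  clique-adj u<2r v<2r u≢v = vv u<2r v<2r (u≢v ∘ toℕ-injective)

  adj-clique-cover : ∀ {u v : Fin N} → HAdj r u v → toℕ u < r + r ⊎ toℕ v < r + r
  adj-clique-cover (vv u<2r _ _)   = inj₁ u<2r
  adj-clique-cover (x₁v _ v<r)     = inj₂ (inA⇒clique v<r)
  adj-clique-cover (vx₁ u<r _)     = inj₁ (inA⇒clique u<r)
  adj-clique-cover (x₂v _ _ v<2r)  = inj₂ v<2r
  adj-clique-cover (vx₂ _ u<2r _)  = inj₁ u<2r

  H-chordal : Chordal (H r)
  H-chordal = split⇒chordal (H r) clique-adj adj-clique-cover (λ i → toℕ i ℕ.<? r + r)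

  x₁-not-in-clique : ¬ toℕ x₁ < r + r
  x₁-not-in-clique x₁<2r = <-irrefl toℕ-x₁ x₁<2r

  x₂-not-in-clique : ¬ toℕ x₂ < r + r
  x₂-not-in-clique x₂<2r = <⇒≱ x₂<2r (≡.subst (r + r ≤_) (≡.sym toℕ-x₂) (ℕ.n≤1+n (r + r)))

  neighbour-x₁⇒inA : ∀ {a} → HAdj r a x₁ → toℕ a < r
  neighbour-x₁⇒inA (vv _ x₁<2r _)   = contradiction x₁<2r x₁-not-in-clique
  neighbour-x₁⇒inA (x₁v _ x₁<r)     = contradiction (inA⇒clique x₁<r) x₁-not-in-clique
  neighbour-x₁⇒inA (vx₁ a<r _)      = a<r
  neighbour-x₁⇒inA (x₂v _ _ x₁<2r)  = contradiction x₁<2r x₁-not-in-clique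
  neighbour-x₁⇒inA (vx₂ _ _ x₁≡2r+1) = contradiction (≡.trans (≡.sym x₁≡2r+1) toℕ-x₁) ℕ.1+n≢n

  neighbour-x₂⇒inB : ∀ {a} → HAdj r a x₂ → r ≤ toℕ a × toℕ a < r + r
  neighbour-x₂⇒inB (vv _ x₂<2r _)   = contradiction x₂<2r x₂-not-in-clique
  neighbour-x₂⇒inB (x₁v _ x₂<r)     = contradiction (inA⇒clique x₂<r) x₂-not-in-clique
  neighbour-x₂⇒inB (vx₁ _ x₂≡2r)    = contradiction (≡.trans (≡.sym toℕ-x₂) x₂≡2r) ℕ.1+n≢n
  neighbour-x₂⇒inB (x₂v _ _ x₂<2r)  = contradiction x₂<2r x₂-not-in-clique
  neighbour-x₂⇒inB (vx₂ r≤a a<2r _) = r≤a , a<2r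

  -- Vertex k < 2r is v_{k+1}; layout a b c d contains A = {v₁ … v_r} if a, B = {v_{r+1} … v_2r} if b,
  -- x₁ if c and x₂ if d.
  layout : Bool → Bool → Bool → Bool → Subset N
  layout a b c d = (replicate r a ++ replicate r b) ++ (c ∷ d ∷ [])

  select : ∀ {i} → Part i → Bool → Bool → Bool → Bool → Bool
  select (inA _)   a b c d = a
  select (inB _ _) a b c d = b
  select isX₁      a b c d = c
  select isX₂      a b c d = d

  lookup-layout : ∀ {i} (p : Part i) a b c d → lookup (layout a b c d) i ≡ select p a b c d
  lookup-layout {i} (inA i<r) a b c d = begin
    lookup (layout a b c d) i                 ≡⟨ lookup-++-< (replicate r a ++ replicate r b) (c ∷ d ∷ []) i i<2r ⟩
    lookup (replicate r a ++ replicate r b) j  ≡⟨ lookup-++-< (replicate r a) (replicate r b) j j<r ⟩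
    lookup (replicate r a) (fromℕ< j<r)       ≡⟨ lookup-replicate (fromℕ< j<r) a ⟩
    a                                         ∎
    where
    i<2r = inA⇒clique i<r
    j = fromℕ< i<2r
    j<r = ≡.subst (_< r) (≡.sym (toℕ-fromℕ< i<2r)) i<r
  lookup-layout {i} (inB r≤i i<2r) a b c d = begin
    lookup (layout a b c d) i                 ≡⟨ lookup-++-< (replicate r a ++ replicate r b) (c ∷ d ∷ []) i i<2r ⟩
    lookup (replicate r a ++ replicate r b) j  ≡⟨ lookup-++-≥ (replicate r a) (replicate r b) j r≤j ⟩
    lookup (replicate r b) (reduce≥ j r≤j)    ≡⟨ lookup-replicate (reduce≥ j r≤j) b ⟩
    b                                         ∎
    where
    j = fromℕ< i<2r
    r≤j = ≡.subst (r ≤_) (≡.sym (toℕ-fromℕ< i<2r)) r≤i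
  lookup-layout isX₁ a b c d = lookup-++ʳ (replicate r a ++ replicate r b) (c ∷ d ∷ []) 0F
  lookup-layout isX₂ a b c d = lookup-++ʳ (replicate r a ++ replicate r b) (c ∷ d ∷ []) 1F

  ∣layout∣ : ∀ a b c d → ∣ layout a b c d ∣ ≡ ∣ replicate r a ∣ + ∣ replicate r b ∣ + ∣ c ∷ d ∷ [] ∣
  ∣layout∣ a b c d = ≡.trans (∣p++q∣≡∣p∣+∣q∣ (replicate r a ++ replicate r b) (c ∷ d ∷ []))
                             (≡.cong (_+ ∣ c ∷ d ∷ [] ∣) (∣p++q∣≡∣p∣+∣q∣ (replicate r a) (replicate r b)))

  ≤-true : ∀ {a b} → a Bool.≤ b → a ≡ true → b ≡ true
  ≤-true Bool.b≤b a≡true = a≡true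

  layout-mono : ∀ {a b c d a′ b′ c′ d′} → a Bool.≤ a′ → b Bool.≤ b′ → c Bool.≤ c′ → d Bool.≤ d′ →
    layout a b c d ⊆ layout a′ b′ c′ d′
  layout-mono {a} {b} {c} {d} {a′} {b′} {c′} {d′} a≤ b≤ c≤ d≤ {i} i∈ = ∈-lookup (lookup-mono (part i))
    where
    lookup-mono : Part i → lookup (layout a′ b′ c′ d′) i ≡ true
    lookup-mono p = ≡.trans (lookup-layout p a′ b′ c′ d′)
                    (select-mono p (≡.trans (≡.sym (lookup-layout p a b c d)) (lookup-∈ i∈)))
      where
      select-mono : ∀ {i} (p : Part i) → select p a b c d ≡ true → select p a′ b′ c′ d′ ≡ true
      select-mono (inA _)   = ≤-true a≤
      select-mono (inB _ _) = ≤-true b≤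
      select-mono isX₁      = ≤-true c≤
      select-mono isX₂      = ≤-true d≤

  ∈-layout : ∀ {i a b c d} (p : Part i) → select p a b c d ≡ true → i ∈ layout a b c d
  ∈-layout {a = a} {b} {c} {d} p selected = ∈-lookup (≡.trans (lookup-layout p a b c d) selected)

  ∉-layout : ∀ {i a b c d} (p : Part i) → select p a b c d ≡ false → i ∉ layout a b c d
  ∉-layout {a = a} {b} {c} {d} p unselected = ∉-lookup (≡.trans (lookup-layout p a b c d) unselected)

  F τ₀ τ₁ A : Subset N
  F  = layout false false true  true
  τ₀ = layout true  false true  true
  τ₁ = layout false true  true  true
  A  = layout true  false false false

  ∣τ₀∣ : ∣ τ₀ ∣ ≡ suc (suc r)
  ∣τ₀∣ = begin
    ∣ τ₀ ∣                    ≡⟨ ∣layout∣ true false true true ⟩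
    ∣ ⊤ {r} ∣ + ∣ ⊥ {r} ∣ + 2  ≡⟨ ≡.cong₂ (λ a b → a + b + 2) (∣⊤∣≡n r) (∣⊥∣≡0 r) ⟩
    r + 0 + 2                 ≡⟨ ≡.cong (_+ 2) (+-identityʳ r) ⟩
    r + 2                     ≡⟨ +-comm r 2 ⟩
    suc (suc r)               ∎

  ∣τ₁∣ : ∣ τ₁ ∣ ≡ suc (suc r)
  ∣τ₁∣ = begin
    ∣ τ₁ ∣                    ≡⟨ ∣layout∣ false true true true ⟩
    ∣ ⊥ {r} ∣ + ∣ ⊤ {r} ∣ + 2  ≡⟨ ≡.cong₂ (λ a b → a + b + 2) (∣⊥∣≡0 r) (∣⊤∣≡n r) ⟩
    r + 2                     ≡⟨ +-comm r 2 ⟩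
    suc (suc r)               ∎

  ∣A∣ : ∣ A ∣ ≡ r
  ∣A∣ = begin
    ∣ A ∣                     ≡⟨ ∣layout∣ true false false false ⟩
    ∣ ⊤ {r} ∣ + ∣ ⊥ {r} ∣ + 0  ≡⟨ ≡.cong₂ (λ a b → a + b + 0) (∣⊤∣≡n r) (∣⊥∣≡0 r) ⟩
    r + 0 + 0                 ≡⟨ ≡.trans (+-identityʳ (r + 0)) (+-identityʳ r) ⟩
    r                         ∎

  ∈A⇒inA : ∀ {v} → v ∈ A → toℕ v < r
  ∈A⇒inA {v} v∈A with part v
  ... | inA v<r      = v<r
  ... | inB r≤v v<2r = contradiction v∈A (∉-layout (inB r≤v v<2r) ≡.refl)
  ... | isX₁         = contradiction v∈A (∉-layout isX₁ ≡.refl)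
  ... | isX₂         = contradiction v∈A (∉-layout isX₂ ≡.refl)

  clique∉F : ∀ {u} → toℕ u < r + r → u ∉ F
  clique∉F {u} u<2r with part u
  ... | inA u<r      = ∉-layout (inA u<r) ≡.refl
  ... | inB r≤u u<2r′ = ∉-layout (inB r≤u u<2r′) ≡.refl
  ... | isX₁         = contradiction u<2r x₁-not-in-clique
  ... | isX₂         = contradiction u<2r x₂-not-in-clique

  suc-r≡r+1 : suc r ≡ r + 1
  suc-r≡r+1 = +-comm 1 r

  τ₀-independent : Ind (r + 1) (H r) τ₀
  τ₀-independent = ≡.subst (λ s → SIndependent s (H r) τ₀) suc-r≡r+1
    (isolated⇒SIndependent (∈-layout isX₂ ≡.refl) x₂-isolated (≤-reflexive ∣τ₀∣))
    where
    x₂-isolated : ∀ {a} → a ∈ τ₀ → ¬ HAdj r a x₂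
    x₂-isolated a∈τ₀ adj = ∉-layout (uncurry inB (neighbour-x₂⇒inB adj)) ≡.refl a∈τ₀

  τ₁-independent : Ind (r + 1) (H r) τ₁
  τ₁-independent = ≡.subst (λ s → SIndependent s (H r) τ₁) suc-r≡r+1
    (isolated⇒SIndependent (∈-layout isX₁ ≡.refl) x₁-isolated (≤-reflexive ∣τ₁∣))
    where
    x₁-isolated : ∀ {a} → a ∈ τ₁ → ¬ HAdj r a x₁
    x₁-isolated a∈τ₁ adj = ∉-layout (inA (neighbour-x₁⇒inA adj)) ≡.refl a∈τ₁

  AB-connected : ∀ {τ v w} → v ∈ τ → w ∈ τ → toℕ v < r → r ≤ toℕ w → toℕ w < r + r →
    ∀ {b} → b ∈ τ → Reach (H r) τ v b
  AB-connected {v = v} v∈τ w∈τ v<r r≤w w<2r {b} b∈τ with v ≟ b | part b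
  ... | yes ≡.refl | _       = here v∈τ
  ... | no v≢b | inA b<r    = step (here v∈τ) (clique-adj (inA⇒clique v<r) (inA⇒clique b<r) v≢b) b∈τ
  ... | no v≢b | inB _ b<2r = step (here v∈τ) (clique-adj (inA⇒clique v<r) b<2r v≢b) b∈τ
  ... | no _   | isX₁       = step (here v∈τ) (vx₁ v<r toℕ-x₁) b∈τ
  ... | no _   | isX₂       = step (step (here v∈τ) (clique-adj (inA⇒clique v<r) w<2r (inA≢inB v<r r≤w)) w∈τ)
                                   (vx₂ r≤w w<2r toℕ-x₂) b∈τ

  K : Complex N
  K = PureSkeleton (Ind (r + 1) (H r)) (suc r)

  L : Complex N
  L = Link K F

  F⊆τ₀ : F ⊆ τ₀
  F⊆τ₀ = layout-mono Bool.f≤t Bool.b≤b Bool.b≤b Bool.b≤b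

  F⊆τ₁ : F ⊆ τ₁
  F⊆τ₁ = layout-mono Bool.b≤b Bool.f≤t Bool.b≤b Bool.b≤b

  F∈K : K F
  F∈K = τ₀ , τ₀-independent , ∣τ₀∣ , F⊆τ₀

  link-face : ∀ {σ τ} → Ind (r + 1) (H r) τ → ∣ τ ∣ ≡ suc (suc r) → σ ⊆ τ → F ⊆ τ →
    (∀ {u} → u ∈ σ → toℕ u < r + r) → L σ
  link-face ind ∣τ∣ σ⊆τ F⊆τ σ-in-clique = (λ _ u∈σ → clique∉F (σ-in-clique u∈σ)) , _ , ind , ∣τ∣ , ∪-⊆ σ⊆τ F⊆τ

  A-cut : ∀ {v w} → v ∈ A → w ∉ A → ¬ L (⁅ v ⁆ ∪ ⁅ w ⁆)
  A-cut {v} {w} v∈A w∉A (disjoint , τ , τ-independent , ∣τ∣ , σ∪F⊆τ) with part w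
  ... | inA w<r      = w∉A (∈-layout (inA w<r) ≡.refl)
  ... | inB r≤w w<2r = connected⇒¬SIndependent (AB-connected v∈τ w∈τ (∈A⇒inA v∈A) r≤w w<2r)
                         (≤-reflexive (≡.trans (≡.cong suc (≡.sym suc-r≡r+1)) (≡.sym ∣τ∣))) τ-independent
    where
    v∈τ = σ∪F⊆τ (x∈p∪q⁺ (inj₁ (x∈p∪q⁺ (inj₁ (x∈⁅x⁆ v)))))
    w∈τ = σ∪F⊆τ (x∈p∪q⁺ (inj₁ (x∈p∪q⁺ (inj₂ (x∈⁅x⁆ w)))))
  ... | isX₁ = disjoint x₁ (x∈p∪q⁺ (inj₂ (x∈⁅x⁆ x₁))) (∈-layout isX₁ ≡.refl)
  ... | isX₂ = disjoint x₂ (x∈p∪q⁺ (inj₂ (x∈⁅x⁆ x₂))) (∈-layout isX₂ ≡.refl)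

  L-A : L A
  L-A = link-face τ₀-independent ∣τ₀∣ (layout-mono Bool.b≤b Bool.b≤b Bool.f≤t Bool.f≤t) F⊆τ₀ (inA⇒clique ∘ ∈A⇒inA)

  ∈⁅⁆-clique : ∀ {z u : Fin N} → toℕ z < r + r → u ∈ ⁅ z ⁆ → toℕ u < r + r
  ∈⁅⁆-clique {z} z<2r u∈⁅z⁆ rewrite x∈⁅y⁆⇒x≡y z u∈⁅z⁆ = z<2r

  <N : ∀ {k} → k ≤ r + r → k < N
  <N k≤2r = ℕ.≤-<-trans k≤2r (ℕ.m<m+n (r + r) (s≤s z≤n))

  z₀ z₁ : Fin N
  z₀ = fromℕ< (<N z≤n)
  z₁ = fromℕ< (<N (m≤m+n r r))

  module _ (0<r : 0 < r) where

    z₀-inA : toℕ z₀ < r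
    z₀-inA = ≡.subst (_< r) (≡.sym (toℕ-fromℕ< (<N z≤n))) 0<r

    z₁-inB : r ≤ toℕ z₁ × toℕ z₁ < r + r
    z₁-inB = ≡.subst (λ k → r ≤ k × k < r + r) (≡.sym (toℕ-fromℕ< (<N (m≤m+n r r))))
                     (≤-refl , ℕ.m<m+n r 0<r)

    z₀∈A : z₀ ∈ A
    z₀∈A = ∈-layout (inA z₀-inA) ≡.refl

    z₁∉A : z₁ ∉ A
    z₁∉A = ∉-layout (uncurry inB z₁-inB) ≡.refl

    L-z₀ : L ⁅ z₀ ⁆
    L-z₀ = link-face τ₀-independent ∣τ₀∣ (⁅x⁆⊆p (∈-layout (inA z₀-inA) ≡.refl)) F⊆τ₀
                     (∈⁅⁆-clique (inA⇒clique z₀-inA))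

    L-z₁ : L ⁅ z₁ ⁆
    L-z₁ = link-face τ₁-independent ∣τ₁∣ (⁅x⁆⊆p (∈-layout (uncurry inB z₁-inB) ≡.refl)) F⊆τ₁
                     (∈⁅⁆-clique (proj₂ z₁-inB))

proposition4p2 : {c ℓ : Level} (r : ℕ) → 2 ≤ r →
    Chordal (H r) ×
    ((𝕜 : Field c ℓ) → ¬ SequentiallyCohenMacaulay 𝕜 (Ind (r + 1) (H r)))
proposition4p2 r 2≤r = H-chordal , λ 𝕜 sequentially-CM →
  ReducedH₀.disconnected⇒¬H̃₀-vanishes 𝕜 L A (L-z₀ 0<r) (L-z₁ 0<r) (z₀∈A 0<r) (z₁∉A 0<r) A-cut
    (sequentially-CM (suc r) (s≤s z≤n) (τ₀ , τ₀-independent , ≤-reflexive (≡.sym ∣τ₀∣))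
                     F F∈K 1 (A , L-A , ≡.subst (1 <_) (≡.sym ∣A∣) 2≤r))
  where
  open Hᵣ r
  0<r : 0 < r
  0<r = <-≤-trans (s≤s z≤n) 2≤r
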